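{- Let $T$ be an algebraic $\sigma$-theory and $t(x,y)$ a $\sigma$-term which is a weak relative closure term for $T$, i.e. writing $u\le w$ for the equation $t(u,w)\approx w$, $\bar x:=t(x,y)$ and $X:=t(t(x,y),x)$, $T$ proves \begin{itemize} \item $t(\bar x,y)\le \bar x$, i.e. $t(t(t(x,y),y),t(x,y))\approx t(x,y)$ (Right-absorption); \item $t(\bar x,t(x,z))\approx t(\bar x,z)$ (Flattening); \item $t(t(X,\bar x),x)\le t(X,x)$ (Weak closure stability). \end{itemize} Let $M$ be a $T$-algebra. Then $M$ satisfies anti-symmetry (for all $a,b\in M$, $t(a,b)=b$ and $t(b,a)=a$ imply $a=b$) if and only if $M$ satisfies the equation $t(t(x,y),x)\approx t(t(t(x,y),x),y)$. Furthermore, if $M$ satisfies both $t(t(x,y),x)\approx t(t(t(x,y),x),y)$ and $y\le t(x,y)$ (i.e. $t(y,t(x,y))\approx t(x,y)$), then $M$ satisfies the Cornish condition $t(t(x,y),x)\approx t(t(y,x),y)$.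
   Context: A $T$-algebra is a set with interpretations of the symbols of $\sigma$ satisfying all equations of $T$ for all values of the variables. -}

module Defs where

open import Data.Nat using (ℕ)
open import Data.Fin using (Fin; zero; suc)
open import Data.Vec using (Vec; tabulate)
open import Data.Product using (_×_; _,_)
open import Relation.Binary.PropositionalEquality using (_≡_)

record Signature : Set₁ where
  field
    Op    : Set
    arity : Op → ℕ
open Signature public

data Term (σ : Signature) (V : Set) : Set where
  var : V → Term σ V
  op  : (f : Op σ) → (Fin (arity σ f) → Term σ V) → Term σ V

subst : ∀ {σ V W} → (V → Term σ W) → Term σ V → Term σ W
subst s (var v)   = s v
subst s (op f ts) = op f (λ i → subst s (ts i))

Equation : Signature → Set
Equation σ = Term σ ℕ × Term σ ℕ

Theory : Signature → Set₁
Theory σ = Equation σ → Set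

infix 4 _⊢_≈_
data _⊢_≈_ {σ : Signature} (T : Theory σ) : Term σ ℕ → Term σ ℕ → Set where
  axiom : ∀ {l r} → T (l , r) → T ⊢ l ≈ r
  refl≈ : ∀ {u} → T ⊢ u ≈ u
  sym≈  : ∀ {u w} → T ⊢ u ≈ w → T ⊢ w ≈ u
  trans≈ : ∀ {u v w} → T ⊢ u ≈ v → T ⊢ v ≈ w → T ⊢ u ≈ w
  cong≈ : ∀ f {ts us} → (∀ i → T ⊢ ts i ≈ us i) → T ⊢ op f ts ≈ op f us
  subst≈ : ∀ (s : ℕ → Term σ ℕ) {u w} → T ⊢ u ≈ w → T ⊢ subst s u ≈ subst s w

record Algebra (σ : Signature) : Set₁ where
  field
    Carrier : Set
    interp  : (f : Op σ) → Vec Carrier (arity σ f) → Carrier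
open Algebra public

⟦_⟧ : ∀ {σ V} {M : Algebra σ} → Term σ V → (V → Carrier M) → Carrier M
⟦_⟧ {M = M} (var v)   ρ = ρ v
⟦_⟧ {M = M} (op f ts) ρ = interp M f (tabulate (λ i → ⟦_⟧ {M = M} (ts i) ρ))

Satisfies : ∀ {σ} (M : Algebra σ) → Equation σ → Set
Satisfies M (l , r) = ∀ (ρ : ℕ → Carrier M) → ⟦_⟧ {M = M} l ρ ≡ ⟦_⟧ {M = M} r ρ

IsTAlgebra : ∀ {σ} (T : Theory σ) (M : Algebra σ) → Set
IsTAlgebra {σ} T M = ∀ (e : Equation σ) → T e → Satisfies M e

x̂ ŷ ẑ : ∀ {σ} → Term σ ℕ
x̂ = var 0
ŷ = var 1
ẑ = var 2

infixl 30 _[_,_]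
_[_,_] : ∀ {σ} → Term σ (Fin 2) → Term σ ℕ → Term σ ℕ → Term σ ℕ
t [ u , w ] = subst (λ { zero → u ; (suc zero) → w }) t

tM : ∀ {σ} (M : Algebra σ) → Term σ (Fin 2) → Carrier M → Carrier M → Carrier M
tM M t a b = ⟦_⟧ {M = M} t (λ { zero → a ; (suc zero) → b })

≤Eq : ∀ {σ} → Term σ (Fin 2) → Term σ ℕ → Term σ ℕ → Equation σ
≤Eq t u w = (t [ u , w ] , w)

record WeakRelClosureTerm {σ : Signature} (T : Theory σ) (t : Term σ (Fin 2)) : Set where
  x̄ : Term σ ℕ
  x̄ = t [ x̂ , ŷ ]
  X : Term σ ℕ
  X = t [ x̄ , x̂ ]
  field
    right-absorption : T ⊢ t [ t [ x̄ , ŷ ] , x̄ ] ≈ x̄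
    flattening       : T ⊢ t [ x̄ , t [ x̂ , ẑ ] ] ≈ t [ x̄ , ẑ ]
    weak-closure-stability :
      T ⊢ t [ t [ t [ X , x̄ ] , x̂ ] , t [ X , x̂ ] ] ≈ t [ X , x̂ ]

AntiSymmetric : ∀ {σ} (M : Algebra σ) → Term σ (Fin 2) → Set
AntiSymmetric M t = ∀ (a b : Carrier M) → tM M t a b ≡ b → tM M t b a ≡ a → a ≡ b

EqA : ∀ {σ} → Term σ (Fin 2) → Equation σ
EqA t = (t [ t [ x̂ , ŷ ] , x̂ ] , t [ t [ t [ x̂ , ŷ ] , x̂ ] , ŷ ])

EqB : ∀ {σ} → Term σ (Fin 2) → Equation σ
EqB t = ≤Eq t ŷ (t [ x̂ , ŷ ])

Cornish : ∀ {σ} → Term σ (Fin 2) → Equation σ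
Cornish t = (t [ t [ x̂ , ŷ ] , x̂ ] , t [ t [ ŷ , x̂ ] , ŷ ])

{-# OPTIONS --safe #-}
module Submission where

open import Defs
open import Data.Fin using (Fin)
open import Data.Product using (_×_)
open import Function.Bundles using (_⇔_)

open import Algebra.Core using (Op₂)
open import Data.Fin using (zero; suc)
open import Data.Nat using (ℕ)
open import Data.Product using (_,_)
open import Data.Vec.Properties using (tabulate-cong)
open import Function.Bundles using (mk⇔; module Equivalence)
open import Level using (0ℓ)
open import Relation.Binary.Core using (Rel)
open import Relation.Binary.Definitions using (Antisymmetric)
open import Relation.Binary.PropositionalEquality
  using (_≡_; refl; sym; trans; cong; cong₂; module ≡-Reasoning)

-- In a T-algebra the axioms on t become identities of a · b = t(a,b), with a ≤ b meaning
-- a · b = b. Flattening and right-absorption give p ≤ p · p ≤ p for every product p = a · b,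
-- so under anti-symmetry products are idempotent and (a · b) · b = a · b. For X = (a · b) · a,
-- flattening then gives X ≤ X · b and weak closure stability gives X · b ≤ X, whence the
-- equation X = X · b; conversely that equation forces anti-symmetry in a few rewrites.
-- For the Cornish condition, b ≤ a · b and X = X · b yield X · Y = X with Y = (b · a) · b;
-- exchanging a and b gives Y · X = Y, and b ≤ a · b once more turns X · Y = X into Y · X = X.

module BinaryOperation {C : Set} (_·_ : Op₂ C) where

  infix 4 _≤_
  _≤_ : Rel C 0ℓ
  a ≤ b = a · b ≡ b

  RightAbsorption Flattening WeakClosureStability EquationA YBelowXY CornishCondition : Set
  RightAbsorption = ∀ x y → (x · y) · y ≤ x · y
  Flattening = ∀ x y z → (x · y) · (x · z) ≡ (x · y) · z
  WeakClosureStability = ∀ x y → (((x · y) · x) · (x · y)) · x ≤ ((x · y) · x) · x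
  EquationA = ∀ x y → (x · y) · x ≡ ((x · y) · x) · y
  YBelowXY = ∀ x y → y ≤ x · y
  CornishCondition = ∀ x y → (x · y) · x ≡ (y · x) · y

  open ≡-Reasoning

  equationA⇒antisym : EquationA → Antisymmetric _≡_ _≤_
  equationA⇒antisym eqA {a} {b} a≤b b≤a = begin
    a               ≡⟨ sym b≤a ⟩
    b · a           ≡⟨ cong (_· a) (sym a≤b) ⟩
    (a · b) · a     ≡⟨ eqA a b ⟩
    ((a · b) · a) · b ≡⟨ cong (λ c → (c · a) · b) a≤b ⟩
    (b · a) · b     ≡⟨ cong (_· b) b≤a ⟩
    a · b           ≡⟨ a≤b ⟩
    b               ∎

  module _ (flat : Flattening) where

    module _ (absorb : RightAbsorption) (antisym : Antisymmetric _≡_ _≤_) where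

      xy∙xy≡xy : ∀ x y → (x · y) · (x · y) ≡ x · y
      xy∙xy≡xy x y = sym (antisym p≤pp pp≤p)
        where
        p = x · y
        pp≡py : p · p ≡ p · y
        pp≡py = flat x y y
        pp≤p : p · p ≤ p
        pp≤p = trans (cong (_· p) pp≡py) (absorb x y)
        p≤pp : p ≤ p · p
        p≤pp = trans (cong (_· (p · p)) (sym pp≤p)) (absorb p p)

      xy∙y≡xy : ∀ x y → (x · y) · y ≡ x · y
      xy∙y≡xy x y = trans (sym (flat x y y)) (xy∙xy≡xy x y)

      antisym⇒equationA : WeakClosureStability → EquationA
      antisym⇒equationA stable x y = antisym X≤Xy Xy≤X
        where
        X = (x · y) · x
        Xx≡X : X · x ≡ X
        Xx≡X = xy∙y≡xy (x · y) x
        X∙xy≡Xy : X · (x · y) ≡ X · y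
        X∙xy≡Xy = trans (cong (X ·_) (sym (xy∙y≡xy x y))) (flat (x · y) x y)
        X≤Xy : X ≤ X · y
        X≤Xy = trans (cong (_· (X · y)) (sym Xx≡X)) (trans (flat X x y) (cong (_· y) Xx≡X))
        Xy∙X≡Xy∙x : (X · y) · X ≡ (X · y) · x
        Xy∙X≡Xy∙x = trans (cong ((X · y) ·_) (sym Xx≡X)) (flat X y x)
        Xy∙X∙X≡X : ((X · y) · X) · X ≡ X
        Xy∙X∙X≡X = begin
          ((X · y) · X) · X             ≡⟨ cong (_· X) Xy∙X≡Xy∙x ⟩
          ((X · y) · x) · X             ≡⟨ sym (cong₂ (λ u v → (u · x) · v) X∙xy≡Xy Xx≡X) ⟩
          ((X · (x · y)) · x) · (X · x) ≡⟨ stable x y ⟩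
          X · x                         ≡⟨ Xx≡X ⟩
          X                             ∎
        Xy≤X : X · y ≤ X
        Xy≤X = trans (sym (xy∙y≡xy (X · y) X)) Xy∙X∙X≡X

    module _ (eqA : EquationA) (below : YBelowXY) where

      xy∙x≡xy∙yx : ∀ x y → (x · y) · x ≡ (x · y) · (y · x)
      xy∙x≡xy∙yx x y = begin
        (x · y) · x                 ≡⟨ cong (_· x) (sym (below x y)) ⟩
        (y · (x · y)) · x           ≡⟨ sym (flat y (x · y) x) ⟩
        (y · (x · y)) · (y · x)     ≡⟨ cong (_· (y · x)) (below x y) ⟩
        (x · y) · (y · x)           ∎

      yx≤xy∙x : ∀ x y → y · x ≤ (x · y) · x
      yx≤xy∙x x y = begin
        (y · x) · ((x · y) · x)       ≡⟨ cong ((y · x) ·_) (xy∙x≡xy∙yx x y) ⟩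
        (y · x) · ((x · y) · (y · x)) ≡⟨ below (x · y) (y · x) ⟩
        (x · y) · (y · x)             ≡⟨ sym (xy∙x≡xy∙yx x y) ⟩
        (x · y) · x                   ∎

      [xy∙x]∙[yx∙y]≡xy∙x : ∀ x y → ((x · y) · x) · ((y · x) · y) ≡ (x · y) · x
      [xy∙x]∙[yx∙y]≡xy∙x x y = begin
        X · ((y · x) · y)               ≡⟨ cong (_· ((y · x) · y)) (sym (yx≤xy∙x x y)) ⟩
        ((y · x) · X) · ((y · x) · y)   ≡⟨ flat (y · x) X y ⟩
        ((y · x) · X) · y               ≡⟨ cong (_· y) (yx≤xy∙x x y) ⟩
        X · y                           ≡⟨ sym (eqA x y) ⟩
        X                               ∎
        where X = (x · y) · x

      cornish : CornishCondition
      cornish x y = begin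
        X           ≡⟨ sym ([xy∙x]∙[yx∙y]≡xy∙x x y) ⟩
        X · Y       ≡⟨ sym (below X Y) ⟩
        Y · (X · Y) ≡⟨ cong (Y ·_) ([xy∙x]∙[yx∙y]≡xy∙x x y) ⟩
        Y · X       ≡⟨ [xy∙x]∙[yx∙y]≡xy∙x y x ⟩
        Y           ∎
        where
        X = (x · y) · x
        Y = (y · x) · y

module Semantics {σ : Signature} (M : Algebra σ) where

  ⟦_⟧ᴹ : ∀ {V} → Term σ V → (V → Carrier M) → Carrier M
  ⟦_⟧ᴹ = ⟦_⟧ {M = M}

  ⟦⟧-cong : ∀ {V} (u : Term σ V) {ρ η : V → Carrier M} → (∀ v → ρ v ≡ η v) → ⟦ u ⟧ᴹ ρ ≡ ⟦ u ⟧ᴹ η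
  ⟦⟧-cong (var v)   ρ≗η = ρ≗η v
  ⟦⟧-cong (op f ts) ρ≗η = cong (interp M f) (tabulate-cong (λ i → ⟦⟧-cong (ts i) ρ≗η))

  ⟦subst⟧ : ∀ {V W} (s : V → Term σ W) (u : Term σ V) (ρ : W → Carrier M) →
            ⟦ subst s u ⟧ᴹ ρ ≡ ⟦ u ⟧ᴹ (λ v → ⟦ s v ⟧ᴹ ρ)
  ⟦subst⟧ s (var v)   ρ = refl
  ⟦subst⟧ s (op f ts) ρ = cong (interp M f) (tabulate-cong (λ i → ⟦subst⟧ s (ts i) ρ))

  sound : ∀ {T : Theory σ} → IsTAlgebra T M → ∀ {l r} → T ⊢ l ≈ r → Satisfies M (l , r)
  sound ⊨T (axiom {l} {r} ax) ρ = ⊨T (l , r) ax ρ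
  sound ⊨T refl≈              ρ = refl
  sound ⊨T (sym≈ d)           ρ = sym (sound ⊨T d ρ)
  sound ⊨T (trans≈ d e)       ρ = trans (sound ⊨T d ρ) (sound ⊨T e ρ)
  sound ⊨T (cong≈ f ds)       ρ = cong (interp M f) (tabulate-cong (λ i → sound ⊨T (ds i) ρ))
  sound ⊨T (subst≈ s {u} {w} d) ρ =
    trans (⟦subst⟧ s u ρ) (trans (sound ⊨T d _) (sym (⟦subst⟧ s w ρ)))

  ⟦t[u,w]⟧ : ∀ (t : Term σ (Fin 2)) u w ρ → ⟦ t [ u , w ] ⟧ᴹ ρ ≡ tM M t (⟦ u ⟧ᴹ ρ) (⟦ w ⟧ᴹ ρ)
  ⟦t[u,w]⟧ t u w ρ = trans (⟦subst⟧ _ t ρ) (⟦⟧-cong t (λ { zero → refl ; (suc zero) → refl }))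

-- Terms built from variables by t alone, so that an equation between them is read in M as an
-- identity of the operation t^M.
data Word : Set where
  atom : ℕ → Word
  _⊗_  : Word → Word → Word

module WordSemantics {σ : Signature} (M : Algebra σ) (t : Term σ (Fin 2)) where

  open Semantics M

  _·_ : Op₂ (Carrier M)
  _·_ = tM M t

  ⌜_⌝ : Word → Term σ ℕ
  ⌜ atom n ⌝ = var n
  ⌜ a ⊗ b ⌝  = t [ ⌜ a ⌝ , ⌜ b ⌝ ]

  evalWord : Word → (ℕ → Carrier M) → Carrier M
  evalWord (atom n) ρ = ρ n
  evalWord (a ⊗ b)  ρ = evalWord a ρ · evalWord b ρ

  ⟦⌜⌝⟧ : ∀ e ρ → ⟦ ⌜ e ⌝ ⟧ᴹ ρ ≡ evalWord e ρ
  ⟦⌜⌝⟧ (atom n) ρ = refl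
  ⟦⌜⌝⟧ (a ⊗ b)  ρ = trans (⟦t[u,w]⟧ t ⌜ a ⌝ ⌜ b ⌝ ρ) (cong₂ _·_ (⟦⌜⌝⟧ a ρ) (⟦⌜⌝⟧ b ρ))

  satisfies⇔ : ∀ l r → Satisfies M (⌜ l ⌝ , ⌜ r ⌝) ⇔ (∀ ρ → evalWord l ρ ≡ evalWord r ρ)
  satisfies⇔ l r = mk⇔
    (λ ⊨l≈r ρ → trans (sym (⟦⌜⌝⟧ l ρ)) (trans (⊨l≈r ρ) (⟦⌜⌝⟧ r ρ)))
    (λ l≡r ρ → trans (⟦⌜⌝⟧ l ρ) (trans (l≡r ρ) (sym (⟦⌜⌝⟧ r ρ))))

  assign : Carrier M → Carrier M → Carrier M → ℕ → Carrier M
  assign a b c 0 = a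
  assign a b c 1 = b
  assign a b c _ = c

  x y z : Word
  x = atom 0
  y = atom 1
  z = atom 2

  open BinaryOperation _·_

  satisfies-EqA⇔ : Satisfies M (EqA t) ⇔ EquationA
  satisfies-EqA⇔ = mk⇔
    (λ ⊨A a b → Equivalence.to (satisfies⇔ l r) ⊨A (assign a b a))
    (λ eqA → Equivalence.from (satisfies⇔ l r) (λ ρ → eqA (ρ 0) (ρ 1)))
    where
    l = (x ⊗ y) ⊗ x
    r = ((x ⊗ y) ⊗ x) ⊗ y

  satisfies-EqB⇒ : Satisfies M (EqB t) → YBelowXY
  satisfies-EqB⇒ ⊨B a b = Equivalence.to (satisfies⇔ (y ⊗ (x ⊗ y)) (x ⊗ y)) ⊨B (assign a b a)

  cornish⇒satisfies : CornishCondition → Satisfies M (Cornish t)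
  cornish⇒satisfies cornish =
    Equivalence.from (satisfies⇔ ((x ⊗ y) ⊗ x) ((y ⊗ x) ⊗ y)) (λ ρ → cornish (ρ 0) (ρ 1))

  module _ {T : Theory σ} (⊨T : IsTAlgebra T M) where

    derivable⇒identity : ∀ l r → T ⊢ ⌜ l ⌝ ≈ ⌜ r ⌝ → ∀ ρ → evalWord l ρ ≡ evalWord r ρ
    derivable⇒identity l r d = Equivalence.to (satisfies⇔ l r) (sound ⊨T d)

    module ClosureLaws (closure : WeakRelClosureTerm T t) where

      open WeakRelClosureTerm closure

      rightAbsorption : RightAbsorption
      rightAbsorption a b =
        derivable⇒identity (((x ⊗ y) ⊗ y) ⊗ (x ⊗ y)) (x ⊗ y) right-absorption (assign a b a)

      flat : Flattening
      flat a b c = derivable⇒identity ((x ⊗ y) ⊗ (x ⊗ z)) ((x ⊗ y) ⊗ z) flattening (assign a b c)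

      weakClosureStability : WeakClosureStability
      weakClosureStability a b =
        derivable⇒identity (((((x ⊗ y) ⊗ x) ⊗ (x ⊗ y)) ⊗ x) ⊗ (((x ⊗ y) ⊗ x) ⊗ x))
                           (((x ⊗ y) ⊗ x) ⊗ x) weak-closure-stability (assign a b a)

mainTheorem3 : (σ : Signature) (T : Theory σ) (t : Term σ (Fin 2)) →
    WeakRelClosureTerm T t →
    (M : Algebra σ) → IsTAlgebra T M →
    (AntiSymmetric M t ⇔ Satisfies M (EqA t))
    × (Satisfies M (EqA t) → Satisfies M (EqB t) → Satisfies M (Cornish t))
mainTheorem3 σ T t closure M ⊨T =
  mk⇔ (λ anti → from (antisym⇒equationA flat rightAbsorption (λ {a} {b} → anti a b)
                                         weakClosureStability))
      (λ ⊨A a b → equationA⇒antisym (to ⊨A))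
  , λ ⊨A ⊨B → cornish⇒satisfies (cornish flat (to ⊨A) (satisfies-EqB⇒ ⊨B))
  where
  open WordSemantics M t
  open ClosureLaws ⊨T closure
  open BinaryOperation _·_
  open Equivalence satisfies-EqA⇔
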